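{- Let $k\ge2$ be an integer and let $b_2,b_3,\dots$ be indeterminates, with $b_1=1$. For $n\ge2$ put $S_{k,n}=\sum_{i=1}^{n-1}\sigma_{2k-1}(i)\,b_{n-i}$. For a positive integer $n$ which is not a prime power, fix a factorization $n=xy$ with $\gcd(x,y)=1$, $x,y>1$, and put \[ E_{k,n}=S_{k,n}-\Big(b_xS_{k,y}+b_yS_{k,x}-\tfrac{4k}{B_{2k}}S_{k,x}S_{k,y}\Big). \] Suppose $l$ is a prime power, $n$ is not a prime power, and $\frac n2<l<n$. Then $b_l$ appears linearly in $E_{k,n}$ (for any such choice of factorization) with coefficient $\sigma_{2k-1}(n-l)$. In particular, if $p$ is a prime power and $p+1$ is not a prime power, then $b_p$ appears linearly in $E_{k,p+1}$ with coefficient $1$.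
   Context: $B_{2k}$ is the Bernoulli number and $\sigma_r(n)=\sum_{d\mid n}d^r$. A prime power means $p^m$ with $p$ prime and $m>0$. The polynomial $E_{k,n}$ expresses, for $g(q)=q+\sum_{n\ge2}b_nq^n$ multiplicative, the condition that the $n$-th coefficient of $E_{2k}(q)g(q)$ equals the product of its $x$-th and $y$-th coefficients, where $E_{2k}(q)=1-\frac{4k}{B_{2k}}\sum_{n\ge1}\sigma_{2k-1}(n)q^n$. -}

module Defs where

open import Data.Nat as ℕ using (ℕ; zero; suc; _∸_; _^_)
open import Data.Nat.Divisibility using (_∣?_)
open import Data.Nat.Primality using (Prime)
open import Data.Nat.Combinatorics using (_C_)
open import Data.Integer using (+_)
open import Data.Rational using (ℚ; 0ℚ; 1ℚ; _+_; _*_; _-_; -_; _/_; 1/_; ≢-nonZero)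
open import Data.Rational.Properties using (_≟_)
open import Data.List using (List; []; _∷_; reverse; zipWith; upTo; map; foldr)
open import Data.Product using (Σ; _×_)
open import Relation.Binary.PropositionalEquality using (_≡_)
open import Relation.Nullary using (yes; no)
open import Relation.Nullary.Decidable using (⌊_⌋)
open import Data.Bool using (if_then_else_)

ℕ→ℚ : ℕ → ℚ
ℕ→ℚ n = (+ n) / 1

sumℚ : List ℚ → ℚ
sumℚ = foldr _+_ 0ℚ

σ : ℕ → ℕ → ℕ
σ r n = foldr ℕ._+_ 0 (map (λ i → if ⌊ suc i ∣? n ⌋ then suc i ^ r else 0) (upTo n))

-- Bernoulli numbers (B_1 = -1/2 convention), via
-- B_0 = 1,  B_m = -(1/(m+1)) Σ_{j=0}^{m-1} C(m+1,j) B_j.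
-- bernRev m = [B_m, B_{m-1}, …, B_0]
bernRev : ℕ → List ℚ
bernRev zero = 1ℚ ∷ []
bernRev (suc m) = next ∷ bs
  where
  bs : List ℚ
  bs = bernRev m
  next : ℚ
  next = - ((+ 1 / (suc (suc m))) *
           sumℚ (zipWith (λ j b → ℕ→ℚ (suc (suc m) C j) * b) (upTo (suc m)) (reverse bs)))

bernoulli : ℕ → ℚ
bernoulli m with bernRev m
... | [] = 0ℚ
... | b ∷ _ = b

-- multiplicative inverse (only ever applied to B_{2k} ≠ 0; value at 0 is irrelevant)
inv : ℚ → ℚ
inv p with p ≟ 0ℚ
... | yes _ = 0ℚ
... | no p≢0 = 1/_ p {{≢-nonZero p≢0}}

IsPrimePower : ℕ → Set
IsPrimePower l = Σ ℕ λ p → Σ ℕ λ m → Prime p × (0 ℕ.< m) × (l ≡ p ^ m)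

-- An assignment of values to the indeterminates b_2, b_3, … is a function
-- b : ℕ → ℚ (only its values at indices ≥ 2 are used); b_1 is fixed to 1.
coef : (ℕ → ℚ) → ℕ → ℚ
coef b i with i ℕ.≟ 1
... | yes _ = 1ℚ
... | no _ = b i

S : ℕ → ℕ → (ℕ → ℚ) → ℚ
S k n b = sumℚ (map (λ j → ℕ→ℚ (σ (2 ℕ.* k ∸ 1) (suc j)) * coef b (n ∸ suc j)) (upTo (n ∸ 1)))

E : ℕ → ℕ → ℕ → ℕ → (ℕ → ℚ) → ℚ
E k n x y b =
  S k n b - ((coef b x * S k y b + coef b y * S k x b)
             - ((ℕ→ℚ (4 ℕ.* k) * inv (bernoulli (2 ℕ.* k))) * (S k x b * S k y b)))

-- Since 2x ≤ xy = n < 2l, both factors satisfy x, y < l, so the correction term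
-- b_x S_{k,y} + b_y S_{k,x} - (4k/B_{2k}) S_{k,x} S_{k,y} only involves b_i with i < l.
-- Hence b_l enters E_{k,n} only through S_{k,n}, where it occurs exactly once, in the
-- summand σ_{2k-1}(n-l) b_l. For n = p + 1 the bound n < 2l holds as p ≥ 2, and σ(1) = 1.
module Submission where

open import Defs
open import Data.Nat using (ℕ; _*_; _<_; _≤_; _∸_; suc)
open import Data.Nat.Coprimality using (Coprime)
open import Data.Rational using (ℚ) renaming (_-_ to _-ℚ_; _*_ to _*ℚ_; 1ℚ to one)
open import Data.Product using (_×_)
open import Relation.Binary.PropositionalEquality using (_≡_; _≢_)
open import Relation.Nullary using (¬_)

open import Data.Nat using (zero; _+_; _^_; _≟_; s≤s; nonTrivial⇒n>1; >-nonZero)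
import Data.Nat.Properties as ℕₚ
open import Data.Nat.Primality using (prime⇒nonTrivial; prime⇒nonZero)
open import Data.Rational using (0ℚ) renaming (_+_ to _+ℚ_)
import Data.Rational.Properties as ℚₚ
open import Data.Rational.Solver using (module +-*-Solver)
open import Data.List using ([]; _∷_; map; upTo; applyUpTo)
open import Data.List.Properties using (map-cong; map-applyUpTo)
open import Data.Product using (_,_)
open import Function using (id; _∘_)
open import Relation.Binary.PropositionalEquality
  using (refl; sym; trans; cong; cong₂; subst; module ≡-Reasoning)
open import Relation.Nullary using (yes; no; contradiction)

open +-*-Solver using (solve; _:+_; _:-_; _:*_; _:=_)

suc[m∸1+n]≡m∸n : ∀ {m n} → n < m → suc (m ∸ suc n) ≡ m ∸ n
suc[m∸1+n]≡m∸n {m} {n} n<m = trans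
  (cong suc (sym (ℕₚ.pred[m∸n]≡m∸[1+n] m n)))
  (ℕₚ.suc-pred (m ∸ n) {{>-nonZero (ℕₚ.m<n⇒0<n∸m n<m)}})

m∸1+[m∸1+n]≡n : ∀ {m n} → n < m → m ∸ suc (m ∸ suc n) ≡ n
m∸1+[m∸1+n]≡n {m} n<m = trans (cong (m ∸_) (suc[m∸1+n]≡m∸n n<m)) (ℕₚ.m∸[m∸n]≡n (ℕₚ.<⇒≤ n<m))

m∸1+n≡o⇒n≡m∸1+o : ∀ {m n o} → 0 < o → m ∸ suc n ≡ o → n ≡ m ∸ suc o
m∸1+n≡o⇒n≡m∸1+o {m} {n} 0<o refl =
  sym (m∸1+[m∸1+n]≡n {m} (ℕₚ.<⇒≤ (ℕₚ.m∸n≢0⇒n<m (ℕₚ.>⇒≢ 0<o))))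

m∸1+n<m∸1 : ∀ {m n} → 0 < n → n < m → m ∸ suc n < m ∸ 1
m∸1+n<m∸1 {m} 0<n n<m = ℕₚ.≤-trans (ℕₚ.≤-reflexive (suc[m∸1+n]≡m∸n n<m)) (ℕₚ.∸-monoʳ-≤ m 0<n)

m*n<2*o⇒m<o : ∀ {m n o} → 2 ≤ n → m * n < 2 * o → m < o
m*n<2*o⇒m<o {m} {n} {o} 2≤n mn<2o = ℕₚ.*-cancelˡ-< 2 m o (begin-strict
  2 * m ≡⟨ ℕₚ.*-comm 2 m ⟩
  m * 2 ≤⟨ ℕₚ.*-monoʳ-≤ m 2≤n ⟩
  m * n <⟨ mn<2o ⟩
  2 * o ∎)
  where open ℕₚ.≤-Reasoning

primePower⇒1< : ∀ {l} → IsPrimePower l → 1 < l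
primePower⇒1< (p , suc m , p-prime , _ , refl) =
  ℕₚ.≤-trans (nonTrivial⇒n>1 p {{prime⇒nonTrivial p-prime}})
             (ℕₚ.m≤m*n p (p ^ m) {{ℕₚ.m^n≢0 p m {{prime⇒nonZero p-prime}}}})

1+n<2*n : ∀ {n} → 1 < n → suc n < 2 * n
1+n<2*n {n} 1<n = subst (suc n <_) (cong (n +_) (sym (ℕₚ.+-identityʳ n))) (ℕₚ.+-monoˡ-< n 1<n)

σ-1 : ∀ r → σ r 1 ≡ 1
σ-1 r = trans (ℕₚ.+-identityʳ (1 ^ r)) (ℕₚ.^-zeroˡ r)

sumℚ-map-− : ∀ (f g : ℕ → ℚ) xs →
  sumℚ (map f xs) -ℚ sumℚ (map g xs) ≡ sumℚ (map (λ i → f i -ℚ g i) xs)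
sumℚ-map-− f g [] = refl
sumℚ-map-− f g (x ∷ xs) = trans
  (solve 4 (λ a s b t → (a :+ s) :- (b :+ t) := (a :- b) :+ (s :- t)) refl
         (f x) (sumℚ (map f xs)) (g x) (sumℚ (map g xs)))
  (cong (f x -ℚ g x +ℚ_) (sumℚ-map-− f g xs))

sumℚ-applyUpTo-zero : ∀ m (g : ℕ → ℚ) → (∀ i → g i ≡ 0ℚ) → sumℚ (applyUpTo g m) ≡ 0ℚ
sumℚ-applyUpTo-zero zero    g g≡0 = refl
sumℚ-applyUpTo-zero (suc m) g g≡0 =
  cong₂ _+ℚ_ (g≡0 0) (sumℚ-applyUpTo-zero m (g ∘ suc) (g≡0 ∘ suc))

sumℚ-applyUpTo-single : ∀ m (g : ℕ → ℚ) i₀ → i₀ < m → (∀ i → i ≢ i₀ → g i ≡ 0ℚ) →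
  sumℚ (applyUpTo g m) ≡ g i₀
sumℚ-applyUpTo-single (suc m) g zero _ off = trans
  (cong (g 0 +ℚ_) (sumℚ-applyUpTo-zero m (g ∘ suc) (λ i → off (suc i) λ ())))
  (ℚₚ.+-identityʳ (g 0))
sumℚ-applyUpTo-single (suc m) g (suc i₀) (s≤s i₀<m) off = trans
  (cong₂ _+ℚ_ (off 0 λ ())
             (sumℚ-applyUpTo-single m (g ∘ suc) i₀ i₀<m
               (λ i i≢i₀ → off (suc i) (i≢i₀ ∘ ℕₚ.suc-injective))))
  (ℚₚ.+-identityˡ _)

coef-cong : ∀ (b b′ : ℕ → ℚ) {i} → b i ≡ b′ i → coef b i ≡ coef b′ i
coef-cong b b′ {i} bi≡b′i with i ≟ 1
... | yes _ = refl
... | no  _ = bi≡b′i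

coef-1< : ∀ (b : ℕ → ℚ) {i} → 1 < i → coef b i ≡ b i
coef-1< b {i} 1<i with i ≟ 1
... | yes i≡1 = contradiction i≡1 (ℕₚ.>⇒≢ 1<i)
... | no  _   = refl

S-cong-≤ : ∀ k m {b b′ : ℕ → ℚ} → (∀ i → i ≤ m → coef b i ≡ coef b′ i) → S k m b ≡ S k m b′
S-cong-≤ k m agree = cong sumℚ (map-cong
  (λ j → cong (ℕ→ℚ (σ (2 * k ∸ 1) (suc j)) *ℚ_) (agree (m ∸ suc j) (ℕₚ.m∸n≤m m (suc j))))
  (upTo (m ∸ 1)))

S-−-single : ∀ k {n l} {b b′ : ℕ → ℚ} → 0 < l → l < n →
  (∀ i → i ≢ l → coef b i ≡ coef b′ i) →
  S k n b -ℚ S k n b′ ≡ ℕ→ℚ (σ (2 * k ∸ 1) (n ∸ l)) *ℚ (coef b l -ℚ coef b′ l)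
S-−-single k {n} {l} {b} {b′} 0<l l<n agree = begin
  S k n b -ℚ S k n b′
    ≡⟨ sumℚ-map-− (term b) (term b′) (upTo (n ∸ 1)) ⟩
  sumℚ (map Δ (upTo (n ∸ 1)))
    ≡⟨ cong sumℚ (map-applyUpTo id Δ (n ∸ 1)) ⟩
  sumℚ (applyUpTo Δ (n ∸ 1))
    ≡⟨ sumℚ-applyUpTo-single (n ∸ 1) Δ j₀ (m∸1+n<m∸1 0<l l<n) Δ-off ⟩
  term b j₀ -ℚ term b′ j₀
    ≡⟨ solve 3 (λ c u v → c :* u :- c :* v := c :* (u :- v)) refl (w j₀) _ _ ⟩
  w j₀ *ℚ (coef b (n ∸ suc j₀) -ℚ coef b′ (n ∸ suc j₀))
    ≡⟨ cong (λ i → w j₀ *ℚ (coef b i -ℚ coef b′ i)) (m∸1+[m∸1+n]≡n l<n) ⟩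
  w j₀ *ℚ (coef b l -ℚ coef b′ l)
    ≡⟨ cong (λ m → ℕ→ℚ (σ (2 * k ∸ 1) m) *ℚ (coef b l -ℚ coef b′ l)) (suc[m∸1+n]≡m∸n l<n) ⟩
  ℕ→ℚ (σ (2 * k ∸ 1) (n ∸ l)) *ℚ (coef b l -ℚ coef b′ l) ∎
  where
  open ≡-Reasoning
  w : ℕ → ℚ
  w j = ℕ→ℚ (σ (2 * k ∸ 1) (suc j))
  term : (ℕ → ℚ) → ℕ → ℚ
  term c j = w j *ℚ coef c (n ∸ suc j)
  Δ : ℕ → ℚ
  Δ j = term b j -ℚ term b′ j
  j₀ : ℕ
  j₀ = n ∸ suc l
  Δ-off : ∀ j → j ≢ j₀ → Δ j ≡ 0ℚ
  Δ-off j j≢j₀ = trans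
    (cong (λ v → term b j -ℚ w j *ℚ v) (sym (agree (n ∸ suc j) (j≢j₀ ∘ m∸1+n≡o⇒n≡m∸1+o {n} 0<l))))
    (ℚₚ.+-inverseʳ (term b j))

E-−-E : ∀ k n x y {b b′ : ℕ → ℚ} →
  (∀ i → i ≤ x → coef b i ≡ coef b′ i) → (∀ i → i ≤ y → coef b i ≡ coef b′ i) →
  E k n x y b -ℚ E k n x y b′ ≡ S k n b -ℚ S k n b′
E-−-E k n x y {b} {b′} agree-x agree-y = begin
  (S k n b -ℚ correction b) -ℚ (S k n b′ -ℚ correction b′)
    ≡⟨ cong (λ r → (S k n b -ℚ correction b) -ℚ (S k n b′ -ℚ r)) (sym correction-agrees) ⟩
  (S k n b -ℚ correction b) -ℚ (S k n b′ -ℚ correction b)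
    ≡⟨ solve 3 (λ s r s′ → (s :- r) :- (s′ :- r) := s :- s′) refl (S k n b) (correction b) (S k n b′) ⟩
  S k n b -ℚ S k n b′ ∎
  where
  open ≡-Reasoning
  correction : (ℕ → ℚ) → ℚ
  correction c = (coef c x *ℚ S k y c +ℚ coef c y *ℚ S k x c)
    -ℚ ((ℕ→ℚ (4 * k) *ℚ inv (bernoulli (2 * k))) *ℚ (S k x c *ℚ S k y c))
  Sx : S k x b ≡ S k x b′
  Sx = S-cong-≤ k x agree-x
  Sy : S k y b ≡ S k y b′
  Sy = S-cong-≤ k y agree-y
  correction-agrees : correction b ≡ correction b′
  correction-agrees = cong₂ _-ℚ_
    (cong₂ _+ℚ_ (cong₂ _*ℚ_ (agree-x x ℕₚ.≤-refl) Sy) (cong₂ _*ℚ_ (agree-y y ℕₚ.≤-refl) Sx))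
    (cong (ℕ→ℚ (4 * k) *ℚ inv (bernoulli (2 * k)) *ℚ_) (cong₂ _*ℚ_ Sx Sy))

E-linear-in-b : ∀ k {n l x y} → n ≡ x * y → 1 < x → 1 < y → n < 2 * l → l < n →
  (b b′ : ℕ → ℚ) → (∀ j → j ≢ l → b j ≡ b′ j) →
  E k n x y b -ℚ E k n x y b′ ≡ ℕ→ℚ (σ (2 * k ∸ 1) (n ∸ l)) *ℚ (b l -ℚ b′ l)
E-linear-in-b k {n} {l} {x} {y} refl 1<x 1<y xy<2l l<xy b b′ b≡b′ = begin
  E k n x y b -ℚ E k n x y b′
    ≡⟨ E-−-E k n x y (agree-below x<l) (agree-below y<l) ⟩
  S k n b -ℚ S k n b′
    ≡⟨ S-−-single k (ℕₚ.<⇒≤ 1<l) l<xy (λ i i≢l → coef-cong b b′ (b≡b′ i i≢l)) ⟩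
  c *ℚ (coef b l -ℚ coef b′ l)
    ≡⟨ cong₂ (λ u v → c *ℚ (u -ℚ v)) (coef-1< b 1<l) (coef-1< b′ 1<l) ⟩
  c *ℚ (b l -ℚ b′ l) ∎
  where
  open ≡-Reasoning
  c : ℚ
  c = ℕ→ℚ (σ (2 * k ∸ 1) (n ∸ l))
  x<l : x < l
  x<l = m*n<2*o⇒m<o 1<y xy<2l
  y<l : y < l
  y<l = m*n<2*o⇒m<o 1<x (subst (_< 2 * l) (ℕₚ.*-comm x y) xy<2l)
  1<l : 1 < l
  1<l = ℕₚ.<-trans 1<x x<l
  agree-below : ∀ {m} → m < l → ∀ i → i ≤ m → coef b i ≡ coef b′ i
  agree-below m<l i i≤m = coef-cong b b′ (b≡b′ i (ℕₚ.<⇒≢ (ℕₚ.≤-<-trans i≤m m<l)))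

E[1+p]-linear-in-bₚ : ∀ k {p x y} → 1 < p → suc p ≡ x * y → 1 < x → 1 < y →
  (b b′ : ℕ → ℚ) → (∀ j → j ≢ p → b j ≡ b′ j) →
  E k (suc p) x y b -ℚ E k (suc p) x y b′ ≡ one *ℚ (b p -ℚ b′ p)
E[1+p]-linear-in-bₚ k {p} {x} {y} 1<p 1+p≡xy 1<x 1<y b b′ b≡b′ = begin
  E k (suc p) x y b -ℚ E k (suc p) x y b′
    ≡⟨ E-linear-in-b k 1+p≡xy 1<x 1<y (1+n<2*n 1<p) (ℕₚ.n<1+n p) b b′ b≡b′ ⟩
  ℕ→ℚ (σ (2 * k ∸ 1) (suc p ∸ p)) *ℚ (b p -ℚ b′ p)
    ≡⟨ cong (λ m → ℕ→ℚ (σ (2 * k ∸ 1) m) *ℚ (b p -ℚ b′ p)) (ℕₚ.m+n∸n≡m 1 p) ⟩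
  ℕ→ℚ (σ (2 * k ∸ 1) 1) *ℚ (b p -ℚ b′ p)
    ≡⟨ cong (λ m → ℕ→ℚ m *ℚ (b p -ℚ b′ p)) (σ-1 (2 * k ∸ 1)) ⟩
  one *ℚ (b p -ℚ b′ p) ∎
  where open ≡-Reasoning

lemma1 : (k : ℕ) → 2 ≤ k →
    ((n l x y : ℕ) → IsPrimePower l → ¬ IsPrimePower n → n < 2 * l → l < n →
      n ≡ x * y → Coprime x y → 1 < x → 1 < y →
      (b b′ : ℕ → ℚ) → (∀ j → j ≢ l → b j ≡ b′ j) →
      E k n x y b -ℚ E k n x y b′ ≡ ℕ→ℚ (σ (2 * k ∸ 1) (n ∸ l)) *ℚ (b l -ℚ b′ l))
    ×
    ((p x y : ℕ) → IsPrimePower p → ¬ IsPrimePower (suc p) →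
      suc p ≡ x * y → Coprime x y → 1 < x → 1 < y →
      (b b′ : ℕ → ℚ) → (∀ j → j ≢ p → b j ≡ b′ j) →
      E k (suc p) x y b -ℚ E k (suc p) x y b′ ≡ one *ℚ (b p -ℚ b′ p))
lemma1 k _ =
  (λ _ _ _ _ _ _ n<2l l<n n≡xy _ 1<x 1<y → E-linear-in-b k n≡xy 1<x 1<y n<2l l<n)
  , λ _ _ _ p-primePower _ 1+p≡xy _ 1<x 1<y →
      E[1+p]-linear-in-bₚ k (primePower⇒1< p-primePower) 1+p≡xy 1<x 1<y
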